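{- Let $\langle M,+,-,0,f\rangle$ be a structure satisfying (A1.1)–(A1.4). Then $<^*$ is a dense linear order on $M$: it is a linear order, and whenever $y<^*z$ there is $x\in M$ with $y<^*x<^*z$.
   Context: $\langle M,+,-,0,f\rangle$ has binary $+$, unary $-$, constant $0$ and unary $f$; $x-y$ means $x+(-y)$. Axioms: (A1.1) $\langle M,+,-,0\rangle$ is a $\mathbb{Z}$-group (satisfies the first-order theory of $\langle\mathbb{Z},+,-,0\rangle$); (A1.2) for all $x,y$, $f(x+y)=f(x)+f(y)$ or $f(x+y)=f(x)+f(y)+1$; (A1.3) for all $x\ne0$, $f(-x)=-f(x)-1$; (A1.4) for all $x\neq0$, $f(f(x))=f(x)+x-1$, and for all $x$, $f(f(x)+x)=2f(x)+x$. Define $x<^*y$ iff $x\neq y$ and $f(y-x)=f(y)-f(x)$. -}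

module Defs where

open import Data.Nat using (ℕ; suc)
open import Data.Fin using (Fin)
open import Data.Vec using (Vec; []; _∷_; lookup)
open import Data.Product using (Σ; _×_)
open import Data.Sum using (_⊎_)
open import Data.Empty using (⊥)
open import Relation.Nullary using (¬_)
open import Relation.Binary.PropositionalEquality using (_≡_)
open import Data.Integer as ℤ using (ℤ)

-- First-order language of (ordered-free) Z-groups: +, -, 0, 1.
-- (The axioms (A1.2),(A1.4) use the constant 1, so 1 is part of the signature.)
data Term (n : ℕ) : Set where
  var  : Fin n → Term n
  _⊕_  : Term n → Term n → Term n
  ⊖_   : Term n → Term n
  zer  : Term n
  one  : Term n

data Formula : ℕ → Set where
  _≐_  : ∀ {n} → Term n → Term n → Formula n
  ⊥'   : ∀ {n} → Formula n
  ¬'_  : ∀ {n} → Formula n → Formula n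
  _∧'_ : ∀ {n} → Formula n → Formula n → Formula n
  _∨'_ : ∀ {n} → Formula n → Formula n → Formula n
  _⇒'_ : ∀ {n} → Formula n → Formula n → Formula n
  ∀'_  : ∀ {n} → Formula (suc n) → Formula n
  ∃'_  : ∀ {n} → Formula (suc n) → Formula n

Sentence : Set
Sentence = Formula 0

record GroupStr : Set₁ where
  field
    Carrier : Set
    add     : Carrier → Carrier → Carrier
    neg     : Carrier → Carrier
    z       : Carrier
    o       : Carrier

module Sem (S : GroupStr) where
  open GroupStr S
  evalT : ∀ {n} → Vec Carrier n → Term n → Carrier
  evalT ρ (var i) = lookup ρ i
  evalT ρ (s ⊕ t) = add (evalT ρ s) (evalT ρ t)
  evalT ρ (⊖ t)   = neg (evalT ρ t)
  evalT ρ zer     = z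
  evalT ρ one     = o

  sat : ∀ {n} → Vec Carrier n → Formula n → Set
  sat ρ (s ≐ t)  = evalT ρ s ≡ evalT ρ t
  sat ρ ⊥'       = ⊥
  sat ρ (¬' φ)   = ¬ sat ρ φ
  sat ρ (φ ∧' ψ) = sat ρ φ × sat ρ ψ
  sat ρ (φ ∨' ψ) = sat ρ φ ⊎ sat ρ ψ
  sat ρ (φ ⇒' ψ) = sat ρ φ → sat ρ ψ
  sat ρ (∀' φ)   = (a : Carrier) → sat (a ∷ ρ) φ
  sat ρ (∃' φ)   = Σ Carrier λ a → sat (a ∷ ρ) φ

_⊨_ : GroupStr → Sentence → Set
S ⊨ φ = Sem.sat S [] φ

ℤ-str : GroupStr
ℤ-str = record { Carrier = ℤ ; add = ℤ._+_ ; neg = ℤ.-_ ; z = ℤ.0ℤ ; o = ℤ.1ℤ }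

IsZGroup : GroupStr → Set
IsZGroup S = (φ : Sentence) → ℤ-str ⊨ φ → S ⊨ φ

record Model : Set₁ where
  field
    grp : GroupStr
  open GroupStr grp public
  field
    f : Carrier → Carrier
  _+_ : Carrier → Carrier → Carrier
  _+_ = add
  -_ : Carrier → Carrier
  -_ = neg
  _-_ : Carrier → Carrier → Carrier
  x - y = x + (- y)
  field
    A1-1  : IsZGroup grp
    A1-2  : ∀ x y → (f (x + y) ≡ f x + f y) ⊎ (f (x + y) ≡ (f x + f y) + o)
    A1-3  : ∀ x → ¬ x ≡ z → f (- x) ≡ (- f x) - o
    A1-4a : ∀ x → ¬ x ≡ z → f (f x) ≡ (f x + x) - o
    A1-4b : ∀ x → f (f x + x) ≡ (f x + f x) + x

  _<*_ : Carrier → Carrier → Set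
  x <* y = ¬ x ≡ y × f (y - x) ≡ f y - f x

{-# OPTIONS --safe #-}
module Submission where

open import Defs
open import Data.Fin using (zero; suc)
open import Data.Nat using (ℕ)
open import Data.Product using (Σ; _×_; _,_; proj₁; proj₂; ∃-syntax)
open import Data.Sum using (_⊎_; inj₁; inj₂)
open import Data.Empty using (⊥-elim)
open import Function using (_∘_)
open import Level using (0ℓ)
open import Relation.Nullary using (¬_)
open import Relation.Nullary.Decidable using (toSum)
open import Relation.Binary.PropositionalEquality
  using (_≡_; refl; sym; trans; cong; cong₂; subst; isEquivalence; resp₂; module ≡-Reasoning)
open import Relation.Binary.Definitions using (Transitive; Trichotomous; tri<; tri≈; tri>)
open import Relation.Binary.Structures using (IsStrictTotalOrder)
open import Algebra.Bundles using (AbelianGroup)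
open import Algebra.Structures using (IsAbelianGroup)
import Data.Integer as ℤ
import Data.Integer.Properties as ℤ
import Algebra.Properties.AbelianGroup as AbelianGroupProperties
import Algebra.Properties.CommutativeSemigroup as CommutativeSemigroupProperties

-- By (A1.1), M is an abelian group with decidable equality in which 1 ≠ 0 and 1 + 1 ≠ 0; nothing
-- else is used from it.  By (A1.2) the carry δ(a,b) = f(a+b) − (f a + f b) is 0 or 1, and x <* y
-- says exactly that x ≠ y and δ(y − x, x) = 0.  Expanding f(a + b + x) in two ways gives the cocycle
-- identity δ(a,b) + δ(a+b,x) = δ(b,x) + δ(a,b+x); since a sum of two carries vanishes only if both
-- do, the carries on one side vanish iff those on the other side do.  This gives transitivity, and
-- density with the witness x = (f d + d) + y where d = w − y, because (A1.3) and (A1.4) force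
-- δ(−f d, f d + d) = 0.  Comparability: a carry δ(y − x, x) = 1 is turned into y <* x by (A1.3).

module ZGroup {S : GroupStr} (isZ : IsZGroup S) where
  open GroupStr S

  -- v₀ is the variable bound by the innermost quantifier.
  private
    v₀ : ∀ {n} → Term (ℕ.suc n)
    v₀ = var zero
    v₁ : ∀ {n} → Term (ℕ.suc (ℕ.suc n))
    v₁ = var (suc zero)
    v₂ : ∀ {n} → Term (ℕ.suc (ℕ.suc (ℕ.suc n)))
    v₂ = var (suc (suc zero))

  +-assoc : ∀ x y w → add (add x y) w ≡ add x (add y w)
  +-assoc = isZ (∀' ∀' ∀' (((v₂ ⊕ v₁) ⊕ v₀) ≐ (v₂ ⊕ (v₁ ⊕ v₀)))) ℤ.+-assoc

  +-comm : ∀ x y → add x y ≡ add y x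
  +-comm = isZ (∀' ∀' ((v₁ ⊕ v₀) ≐ (v₀ ⊕ v₁))) ℤ.+-comm

  +-identityˡ : ∀ x → add z x ≡ x
  +-identityˡ = isZ (∀' ((zer ⊕ v₀) ≐ v₀)) ℤ.+-identityˡ

  +-identityʳ : ∀ x → add x z ≡ x
  +-identityʳ = isZ (∀' ((v₀ ⊕ zer) ≐ v₀)) ℤ.+-identityʳ

  +-inverseˡ : ∀ x → add (neg x) x ≡ z
  +-inverseˡ = isZ (∀' (((⊖ v₀) ⊕ v₀) ≐ zer)) ℤ.+-inverseˡ

  +-inverseʳ : ∀ x → add x (neg x) ≡ z
  +-inverseʳ = isZ (∀' ((v₀ ⊕ (⊖ v₀)) ≐ zer)) ℤ.+-inverseʳ

  _≟_ : ∀ x y → x ≡ y ⊎ ¬ x ≡ y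
  _≟_ = isZ (∀' ∀' ((v₁ ≐ v₀) ∨' (¬' (v₁ ≐ v₀)))) (λ m n → toSum (m ℤ.≟ n))

  1≢0 : ¬ o ≡ z
  1≢0 = isZ (¬' (one ≐ zer)) (λ ())

  1+1≢0 : ¬ add o o ≡ z
  1+1≢0 = isZ (¬' ((one ⊕ one) ≐ zer)) (λ ())

  isAbelianGroup : IsAbelianGroup _≡_ add z neg
  isAbelianGroup = record
    { isGroup = record
      { isMonoid = record
        { isSemigroup = record
          { isMagma = record { isEquivalence = isEquivalence ; ∙-cong = cong₂ add }
          ; assoc = +-assoc
          }
        ; identity = +-identityˡ , +-identityʳ
        }
      ; inverse = +-inverseˡ , +-inverseʳ
      ; ⁻¹-cong = cong neg
      }
    ; comm = +-comm
    }

  abelianGroup : AbelianGroup 0ℓ 0ℓ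
  abelianGroup = record { isAbelianGroup = isAbelianGroup }

module StarOrder (𝓜 : Model) where
  open Model 𝓜
  open ZGroup A1-1
  open AbelianGroup abelianGroup using (assoc; comm; identityˡ; identityʳ; inverseˡ; commutativeSemigroup)
  open AbelianGroupProperties abelianGroup
  open CommutativeSemigroupProperties commutativeSemigroup using (xy∙z≈xz∙y)
  open ≡-Reasoning

  δ : Carrier → Carrier → Carrier
  δ a b = (- (f a + f b)) + f (a + b)

  IsBit : Carrier → Set
  IsBit u = u ≡ z ⊎ u ≡ o

  bits-sum-zero : ∀ {u v} → IsBit u → IsBit v → u + v ≡ z → u ≡ z × v ≡ z
  bits-sum-zero (inj₁ refl) (inj₁ refl) _ = refl , refl
  bits-sum-zero (inj₁ refl) (inj₂ refl) h = ⊥-elim (1≢0 (trans (sym (identityˡ o)) h))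
  bits-sum-zero (inj₂ refl) (inj₁ refl) h = ⊥-elim (1≢0 (trans (sym (identityʳ o)) h))
  bits-sum-zero (inj₂ refl) (inj₂ refl) h = ⊥-elim (1+1≢0 h)

  δ-bit : ∀ a b → IsBit (δ a b)
  δ-bit a b with A1-2 a b
  ... | inj₁ e = inj₁ (sym (y≈x\\z (f a + f b) z (f (a + b)) (trans (identityʳ _) (sym e))))
  ... | inj₂ e = inj₂ (sym (y≈x\\z (f a + f b) o (f (a + b)) (sym e)))

  f-+ : ∀ a b → f (a + b) ≡ (f a + f b) + δ a b
  f-+ a b = sym (\\-leftDividesˡ (f a + f b) (f (a + b)))

  δ-cocycle : ∀ a b x → δ a b + δ (a + b) x ≡ δ b x + δ a (b + x)
  δ-cocycle a b x = ∙-cancelˡ ((f a + f b) + f x) _ _ (begin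
    ((f a + f b) + f x) + (δ a b + δ (a + b) x)  ≡⟨ assoc _ _ _ ⟨
    (((f a + f b) + f x) + δ a b) + δ (a + b) x  ≡⟨ cong (_+ δ (a + b) x) (xy∙z≈xz∙y _ _ _) ⟩
    (((f a + f b) + δ a b) + f x) + δ (a + b) x  ≡⟨ cong (λ t → (t + f x) + δ (a + b) x) (f-+ a b) ⟨
    (f (a + b) + f x) + δ (a + b) x              ≡⟨ f-+ (a + b) x ⟨
    f ((a + b) + x)                              ≡⟨ cong f (assoc a b x) ⟩
    f (a + (b + x))                              ≡⟨ f-+ a (b + x) ⟩
    (f a + f (b + x)) + δ a (b + x)              ≡⟨ cong (λ t → (f a + t) + δ a (b + x)) (f-+ b x) ⟩
    (f a + ((f b + f x) + δ b x)) + δ a (b + x)  ≡⟨ cong (_+ δ a (b + x)) (assoc _ _ _) ⟨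
    ((f a + (f b + f x)) + δ b x) + δ a (b + x)  ≡⟨ cong (λ t → (t + δ b x) + δ a (b + x)) (assoc _ _ _) ⟨
    (((f a + f b) + f x) + δ b x) + δ a (b + x)  ≡⟨ assoc _ _ _ ⟩
    ((f a + f b) + f x) + (δ b x + δ a (b + x))  ∎)

  δ-shift : ∀ a b x → δ a b ≡ z → δ (a + b) x ≡ z → δ b x ≡ z × δ a (b + x) ≡ z
  δ-shift a b x p q = bits-sum-zero (δ-bit b x) (δ-bit a (b + x)) (begin
    δ b x + δ a (b + x)      ≡⟨ δ-cocycle a b x ⟨
    δ a b + δ (a + b) x      ≡⟨ cong₂ _+_ p q ⟩
    z + z                    ≡⟨ identityˡ z ⟩
    z                        ∎)

  δ-unshift : ∀ a b x → δ b x ≡ z → δ a (b + x) ≡ z → δ a b ≡ z × δ (a + b) x ≡ z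
  δ-unshift a b x p q = bits-sum-zero (δ-bit a b) (δ-bit (a + b) x) (begin
    δ a b + δ (a + b) x      ≡⟨ δ-cocycle a b x ⟩
    δ b x + δ a (b + x)      ≡⟨ cong₂ _+_ p q ⟩
    z + z                    ≡⟨ identityˡ z ⟩
    z                        ∎)

  x≢y⇒y-x≢0 : ∀ {x y} → ¬ x ≡ y → ¬ (y - x) ≡ z
  x≢y⇒y-x≢0 x≢y = x≢y ∘ sym ∘ x∙y⁻¹≈ε⇒x≈y _ _

  <*⇒δ≡0 : ∀ {x y} → x <* y → δ (y - x) x ≡ z
  <*⇒δ≡0 {x} {y} (_ , fy-x) = sym (y≈x\\z _ z _ (begin
    (f (y - x) + f x) + z    ≡⟨ identityʳ _ ⟩
    f (y - x) + f x          ≡⟨ cong (_+ f x) fy-x ⟩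
    (f y - f x) + f x        ≡⟨ //-rightDividesˡ (f x) (f y) ⟩
    f y                      ≡⟨ cong f (//-rightDividesˡ x y) ⟨
    f ((y - x) + x)          ∎))

  δ≡0⇒<* : ∀ {x y} a → a + x ≡ y → ¬ x ≡ y → δ a x ≡ z → x <* y
  δ≡0⇒<* {x} {y} a a+x≡y x≢y δ≡0 = x≢y , (begin
    f (y - x)                ≡⟨ cong f (x≈z//y a x y a+x≡y) ⟨
    f a                      ≡⟨ x≈z//y (f a) (f x) (f y) fa+fx≡fy ⟩
    f y - f x                ∎)
    where
    fa+fx≡fy : f a + f x ≡ f y
    fa+fx≡fy = begin
      f a + f x              ≡⟨ identityʳ _ ⟨
      (f a + f x) + z        ≡⟨ cong ((f a + f x) +_) δ≡0 ⟨
      (f a + f x) + δ a x    ≡⟨ f-+ a x ⟨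
      f (a + x)              ≡⟨ cong f a+x≡y ⟩
      f y                    ∎

  f-neg : ∀ {a u} → ¬ a ≡ z → f a + o ≡ u → f (- a) ≡ - u
  f-neg {a} {u} a≢0 fa+1≡u = begin
    f (- a)                  ≡⟨ A1-3 a a≢0 ⟩
    (- f a) - o              ≡⟨ ⁻¹-∙-comm (f a) o ⟩
    - (f a + o)              ≡⟨ cong -_ fa+1≡u ⟩
    - u                      ∎

  <*-asym : ∀ {x y} → x <* y → ¬ y <* x
  <*-asym {x} {y} (x≢y , fy-x) (_ , fx-y) = 1≢0 (identityʳ-unique (f y - f x) o (⁻¹-injective (begin
    - ((f y - f x) + o)      ≡⟨ f-neg (x≢y⇒y-x≢0 x≢y) (cong (_+ o) fy-x) ⟨
    f (- (y - x))            ≡⟨ cong f (⁻¹-anti-homo‿- y x) ⟩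
    f (x - y)                ≡⟨ fx-y ⟩
    f x - f y                ≡⟨ ⁻¹-anti-homo‿- (f y) (f x) ⟨
    - (f y - f x)            ∎)))

  <*-irrefl : ∀ {x} → ¬ x <* x
  <*-irrefl (x≢x , _) = x≢x refl

  <*-trans : Transitive _<*_
  <*-trans {x} {y} {w} x<y y<w = δ≡0⇒<* (a + b) a+b+x≡w x≢w δ[a+b]x≡0
    where
    a b : Carrier
    a = w - y
    b = y - x
    b+x≡y : b + x ≡ y
    b+x≡y = //-rightDividesˡ x y
    δa[b+x]≡0 : δ a (b + x) ≡ z
    δa[b+x]≡0 = subst (λ t → δ a t ≡ z) (sym b+x≡y) (<*⇒δ≡0 y<w)
    δ[a+b]x≡0 : δ (a + b) x ≡ z
    δ[a+b]x≡0 = proj₂ (δ-unshift a b x (<*⇒δ≡0 x<y) δa[b+x]≡0)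
    a+b+x≡w : (a + b) + x ≡ w
    a+b+x≡w = trans (assoc a b x) (trans (cong (a +_) b+x≡y) (//-rightDividesˡ y w))
    x≢w : ¬ x ≡ w
    x≢w refl = <*-asym x<y y<w

  δ≡1⇒>* : ∀ {x y} → ¬ x ≡ y → δ (y - x) x ≡ o → y <* x
  δ≡1⇒>* {x} {y} x≢y δ≡1 = x≢y ∘ sym , (begin
    f (x - y)                ≡⟨ cong f (⁻¹-anti-homo‿- y x) ⟨
    f (- (y - x))            ≡⟨ f-neg (x≢y⇒y-x≢0 x≢y) (x≈z//y _ (f x) (f y) fy-x+1+fx≡fy) ⟩
    - (f y - f x)            ≡⟨ ⁻¹-anti-homo‿- (f y) (f x) ⟩
    f x - f y                ∎)
    where
    fy-x+1+fx≡fy : (f (y - x) + o) + f x ≡ f y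
    fy-x+1+fx≡fy = begin
      (f (y - x) + o) + f x            ≡⟨ xy∙z≈xz∙y _ _ _ ⟩
      (f (y - x) + f x) + o            ≡⟨ cong ((f (y - x) + f x) +_) δ≡1 ⟨
      (f (y - x) + f x) + δ (y - x) x  ≡⟨ f-+ (y - x) x ⟨
      f ((y - x) + x)                  ≡⟨ cong f (//-rightDividesˡ x y) ⟩
      f y                              ∎

  <*-compare : Trichotomous _≡_ _<*_
  <*-compare x y with x ≟ y
  ... | inj₁ refl = tri≈ <*-irrefl refl <*-irrefl
  ... | inj₂ x≢y with δ-bit (y - x) x
  ...   | inj₁ δ≡0 = tri< x<y x≢y (<*-asym x<y)
    where
    x<y : x <* y
    x<y = δ≡0⇒<* (y - x) (//-rightDividesˡ x y) x≢y δ≡0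
  ...   | inj₂ δ≡1 = tri> (λ x<y → <*-asym x<y y<x) x≢y y<x
    where
    y<x : y <* x
    y<x = δ≡1⇒>* x≢y δ≡1

  isStrictTotalOrder : IsStrictTotalOrder _≡_ _<*_
  isStrictTotalOrder = record
    { isStrictPartialOrder = record
      { isEquivalence = isEquivalence
      ; irrefl = λ { refl → <*-irrefl }
      ; trans = <*-trans
      ; <-resp-≈ = resp₂ _<*_
      }
    ; compare = <*-compare
    }

  f≢0 : ∀ {a} → ¬ a ≡ z → ¬ f a ≡ z
  f≢0 {a} a≢0 fa≡0 = a≢0 (begin
    a                        ≡⟨ identityˡ a ⟨
    z + a                    ≡⟨ cong (_+ a) (identityˡ z) ⟨
    (z + z) + a              ≡⟨ cong (λ t → (t + t) + a) fa≡0 ⟨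
    (f a + f a) + a          ≡⟨ A1-4b a ⟨
    f (f a + a)              ≡⟨ cong (λ t → f (t + a)) fa≡0 ⟩
    f (z + a)                ≡⟨ cong f (identityˡ a) ⟩
    f a                      ≡⟨ fa≡0 ⟩
    z                        ∎)

  f≢neg : ∀ {a} → ¬ a ≡ z → ¬ f a ≡ - a
  f≢neg {a} a≢0 fa≡-a = a≢0 (∙-cancelʳ (- o) a z (begin
    a - o                    ≡⟨ cong (_- o) (⁻¹-involutive a) ⟨
    (- (- a)) - o            ≡⟨ cong (λ t → (- t) - o) fa≡-a ⟨
    (- f a) - o              ≡⟨ A1-3 a a≢0 ⟨
    f (- a)                  ≡⟨ cong f fa≡-a ⟨
    f (f a)                  ≡⟨ A1-4a a a≢0 ⟩
    (f a + a) - o            ≡⟨ cong (λ t → (t + a) - o) fa≡-a ⟩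
    ((- a) + a) - o          ≡⟨ cong (_- o) (inverseˡ a) ⟩
    z - o                    ∎))

  f-neg-f : ∀ {a} → ¬ a ≡ z → f (- f a) ≡ - (f a + a)
  f-neg-f {a} a≢0 = f-neg (f≢0 a≢0) (trans (cong (_+ o) (A1-4a a a≢0)) (//-rightDividesˡ o (f a + a)))

  δ-neg-f : ∀ {d} → ¬ d ≡ z → δ (- f d) (f d + d) ≡ z
  δ-neg-f {d} d≢0 = begin
    (- (f (- f d) + f e)) + f ((- f d) + e)  ≡⟨ cong (λ s → (- s) + f ((- f d) + e)) f-fd+fe≡fd ⟩
    (- f d) + f ((- f d) + e)                ≡⟨ cong (λ t → (- f d) + f t) (\\-leftDividesʳ (f d) d) ⟩
    (- f d) + f d                            ≡⟨ inverseˡ (f d) ⟩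
    z                                        ∎
    where
    e : Carrier
    e = f d + d
    f-fd+fe≡fd : f (- f d) + f e ≡ f d
    f-fd+fe≡fd = begin
      f (- f d) + f e          ≡⟨ cong₂ _+_ (f-neg-f d≢0) (trans (A1-4b d) (assoc _ _ _)) ⟩
      (- e) + (f d + e)        ≡⟨ comm _ _ ⟩
      (f d + e) - e            ≡⟨ //-rightDividesʳ e (f d) ⟩
      f d                      ∎

  <*-dense : ∀ y w → y <* w → ∃[ x ] y <* x × x <* w
  <*-dense y w y<w = x , δ≡0⇒<* e refl y≢x δey≡0 , δ≡0⇒<* (- f d) -fd+x≡w x≢w δ[-fd]x≡0
    where
    d e x : Carrier
    d = w - y
    e = f d + d
    x = e + y
    d≢0 : ¬ d ≡ z
    d≢0 = x≢y⇒y-x≢0 (proj₁ y<w)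
    -fd+e≡d : (- f d) + e ≡ d
    -fd+e≡d = \\-leftDividesʳ (f d) d
    shifted : δ e y ≡ z × δ (- f d) x ≡ z
    shifted = δ-shift (- f d) e y (δ-neg-f d≢0) (subst (λ t → δ t y ≡ z) (sym -fd+e≡d) (<*⇒δ≡0 y<w))
    δey≡0 : δ e y ≡ z
    δey≡0 = proj₁ shifted
    δ[-fd]x≡0 : δ (- f d) x ≡ z
    δ[-fd]x≡0 = proj₂ shifted
    -fd+x≡w : (- f d) + x ≡ w
    -fd+x≡w = trans (sym (assoc _ _ _)) (trans (cong (_+ y) -fd+e≡d) (//-rightDividesˡ y w))
    y≢x : ¬ y ≡ x
    y≢x y≡x = f≢neg d≢0 (inverseˡ-unique (f d) d (identityˡ-unique e y (sym y≡x)))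
    x≢w : ¬ x ≡ w
    x≢w x≡w = f≢0 d≢0 (⁻¹-injective (trans -fd≡0 (sym ε⁻¹≈ε)))
      where
      -fd≡0 : - f d ≡ z
      -fd≡0 = identityˡ-unique (- f d) w (subst (λ t → (- f d) + t ≡ w) x≡w -fd+x≡w)

theorem2p5 : (𝓜 : Model) →
    IsStrictTotalOrder {A = Model.Carrier 𝓜} _≡_ (Model._<*_ 𝓜)
    × (∀ y w → Model._<*_ 𝓜 y w →
    Σ (Model.Carrier 𝓜) λ x → Model._<*_ 𝓜 y x × Model._<*_ 𝓜 x w)
theorem2p5 𝓜 = isStrictTotalOrder , <*-dense
  where open StarOrder 𝓜
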